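{- Let $n\ge 2$ and $T\ge 1$ be integers and let $Z'$ be a connected induced subgraph of the diagonal grid graph $D_{n-1,T}$. Then there exist a labeling $\lambda$ and an integer $n'\le n$ such that $Z'$ is isomorphic to the $2$-temporal line graph $L_2((P_{n'},\lambda))$.
   Context: The diagonal grid graph $D_{n,m}$ has vertices $v_{i,j}$ for $i\in[n]$, $j\in[m]$, and an edge $\{v_{i,j},v_{i',j'}\}$ (for distinct vertices) iff $|i-i'|^2+|j-j'|^2\le 2$. $P_{n}$ is the path on $n$ vertices. A temporal graph $(G,\lambda)$ consists of a static graph $G=(V,E)$ and a labeling $\lambda:E\to 2^{\mathbb N}\setminus\{\emptyset\}$. For $\Delta\in\mathbb N$, the $\Delta$-temporal line graph $L_\Delta(\mathcal G)$ of $\mathcal G=(G,\lambda)$ has vertex set $\{e_t: e\in E, t\in\lambda(e)\}$ and edge set $\{\{e_t,e'_{t'}\}: e_t\neq e'_{t'},\ e\cap e'\ne\emptyset,\ |t-t'|<\Delta\}$. -}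

module Defs where

open import Data.Nat using (ℕ; zero; suc; _+_; _*_; _∸_; _≤_; _<_; ∣_-_∣)
open import Data.Fin using (Fin; toℕ)
open import Data.Bool using (Bool; T)
open import Data.Product using (Σ; ∃; ∃-syntax; _×_; _,_; proj₁; proj₂)
open import Data.Sum using (_⊎_)
open import Data.Empty using (⊥)
open import Relation.Nullary using (¬_)
open import Relation.Binary.PropositionalEquality using (_≡_)
open import Function.Bundles using (_↔_; Inverse)

record Graph : Set₁ where
  field
    Vertex : Set
    Adj    : Vertex → Vertex → Set
open Graph public

_≅_ : Graph → Graph → Set
G ≅ H = Σ (Vertex G ↔ Vertex H) λ f →
  ∀ u v → (Adj G u v → Adj H (Inverse.to f u) (Inverse.to f v))
        × (Adj H (Inverse.to f u) (Inverse.to f v) → Adj G u v)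

data Walk (G : Graph) : Vertex G → Vertex G → Set where
  here : ∀ {u} → Walk G u u
  step : ∀ {u v w} → Adj G u v → Walk G v w → Walk G u w

Connected : Graph → Set
Connected G = ∀ u v → Walk G u v

Induced : (G : Graph) → (Vertex G → Bool) → Graph
Induced G S = record
  { Vertex = Σ (Vertex G) (λ v → T (S v))
  ; Adj    = λ u v → Adj G (proj₁ u) (proj₁ v) }

-- Diagonal grid graph D_{n,m}: vertices v_{i,j}, i ∈ [n], j ∈ [m] (0-indexed here);
-- distinct vertices adjacent iff |i-i'|^2 + |j-j'|^2 ≤ 2.
DiagGrid : ℕ → ℕ → Graph
DiagGrid n m = record
  { Vertex = Fin n × Fin m
  ; Adj    = λ u v → ¬ (u ≡ v) ×
      (∣ toℕ (proj₁ u) - toℕ (proj₁ v) ∣ * ∣ toℕ (proj₁ u) - toℕ (proj₁ v) ∣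
       + ∣ toℕ (proj₂ u) - toℕ (proj₂ v) ∣ * ∣ toℕ (proj₂ u) - toℕ (proj₂ v) ∣ ≤ 2) }

-- Edges of the path P_n (vertices Fin n): the edges are {u, u+1}; we represent
-- each edge by its ordered pair (u , v) with v = u + 1.
PathEdge : ℕ → Set
PathEdge n = Σ (Fin n × Fin n) λ p → toℕ (proj₂ p) ≡ suc (toℕ (proj₁ p))

_∈ₑ_ : ∀ {n} → Fin n → PathEdge n → Set
x ∈ₑ ((u , v) , _) = (x ≡ u) ⊎ (x ≡ v)

record PathLabeling (n : ℕ) : Set where
  field
    label    : PathEdge n → ℕ → Bool
    nonempty : ∀ e → ∃[ t ] T (label e t)
open PathLabeling public

TemporalLineGraph : (Δ n : ℕ) → PathLabeling n → Graph
TemporalLineGraph Δ n λ' = record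
  { Vertex = Σ (PathEdge n) λ e → Σ ℕ λ t → T (label λ' e t)
  ; Adj    = λ x y →
      ¬ (x ≡ y)
      × (∃[ w ] (w ∈ₑ proj₁ x × w ∈ₑ proj₁ y))
      × ∣ proj₁ (proj₂ x) - proj₁ (proj₂ y) ∣ < Δ }

-- The rows occupied by a connected induced subgraph Z′ of the diagonal grid form an
-- interval [a, b], because a walk changes the row by at most one per step.  Send the cell
-- (r, t) to the edge {r − a, r − a + 1} of the path on b − a + 2 vertices at time t, and
-- label each edge with the columns occupied in its row.  In the grid, distinct cells are
-- adjacent iff both coordinates differ by at most one; in L₂ two time-edges are adjacent iff
-- the edges share an endpoint, i.e. their lower endpoints differ by at most one, and their
-- times differ by at most one.  So both graphs are the king's-move graph on the occupied cells.
module Submission where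

open import Defs
open import Data.Nat using (ℕ; zero; suc; _+_; _*_; _∸_; _≤_; _<_; z≤n; s≤s; s≤s⁻¹; ∣_-_∣; _≟_)
open import Data.Nat.Properties
open import Data.Fin using (Fin; toℕ; fromℕ<)
open import Data.Fin.Properties using (toℕ-injective; toℕ-fromℕ<; toℕ<n; any?)
open import Data.Bool using (Bool; T; T?)
open import Data.Bool.Properties using (T-irrelevant)
open import Data.Product using (Σ; ∃; ∃-syntax; _×_; _,_; proj₁; proj₂)
open import Data.Product.Properties using (,-injective) renaming (≡-dec to ×-≡-dec)
open import Data.Sum using (_⊎_; inj₁; inj₂)
open import Data.Empty using (⊥-elim)
open import Data.Unit using (⊤; tt)
open import Relation.Nullary using (¬_; Dec; yes; no; contradiction)
open import Relation.Nullary.Decidable using (map′; _×-dec_; ⌊_⌋; True; toWitness; fromWitness)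
open import Relation.Unary using (Decidable)
open import Relation.Binary.PropositionalEquality
open import Function.Base using (_∘_)
open import Function.Bundles using (_⇔_; mk⇔; mk↔ₛ′; Equivalence)

square≤2⇒≤1 : ∀ d → d * d ≤ 2 → d ≤ 1
square≤2⇒≤1 zero          _ = z≤n
square≤2⇒≤1 (suc zero)    _ = s≤s z≤n
square≤2⇒≤1 (suc (suc d)) h = contradiction (≤-trans (*-mono-≤ {2} {_} {2} 2≤d+2 2≤d+2) h) λ { (s≤s (s≤s ())) }
  where 2≤d+2 = s≤s (s≤s (z≤n {d}))

squares≤2⇔≤1 : ∀ d e → d * d + e * e ≤ 2 ⇔ (d ≤ 1 × e ≤ 1)
squares≤2⇔≤1 d e = mk⇔
  (λ h → square≤2⇒≤1 d (m+n≤o⇒m≤o (d * d) h) , square≤2⇒≤1 e (m+n≤o⇒n≤o (d * d) h))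
  (λ (d≤1 , e≤1) → +-mono-≤ (*-mono-≤ d≤1 d≤1) (*-mono-≤ e≤1 e≤1))

Near : ℕ → ℕ → Set
Near m n = m ≡ n ⊎ m ≡ suc n ⊎ n ≡ suc m

∣m-n∣≤1⇒Near : ∀ m n → ∣ m - n ∣ ≤ 1 → Near m n
∣m-n∣≤1⇒Near zero          zero          _ = inj₁ refl
∣m-n∣≤1⇒Near zero          (suc zero)    _ = inj₂ (inj₂ refl)
∣m-n∣≤1⇒Near (suc zero)    zero          _ = inj₂ (inj₁ refl)
∣m-n∣≤1⇒Near zero          (suc (suc _)) (s≤s ())
∣m-n∣≤1⇒Near (suc (suc _)) zero          (s≤s ())
∣m-n∣≤1⇒Near (suc m)       (suc n)       h with ∣m-n∣≤1⇒Near m n h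
... | inj₁ m≡n          = inj₁ (cong suc m≡n)
... | inj₂ (inj₁ m≡1+n) = inj₂ (inj₁ (cong suc m≡1+n))
... | inj₂ (inj₂ n≡1+m) = inj₂ (inj₂ (cong suc n≡1+m))

Near⇒∣m-n∣≤1 : ∀ m n → Near m n → ∣ m - n ∣ ≤ 1
Near⇒∣m-n∣≤1 m        .m       (inj₁ refl)        = subst (_≤ 1) (sym (∣n-n∣≡0 m)) z≤n
Near⇒∣m-n∣≤1 .(suc n) n        (inj₂ (inj₁ refl)) = ≤-reflexive (trans (m≤n⇒∣n-m∣≡n∸m (n≤1+n n)) (m+n∸n≡m 1 n))
Near⇒∣m-n∣≤1 m        .(suc m) (inj₂ (inj₂ refl)) = ≤-reflexive (trans (m≤n⇒∣m-n∣≡n∸m (n≤1+n m)) (m+n∸n≡m 1 m))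

King : ℕ × ℕ → ℕ × ℕ → Set
King (r , t) (r′ , t′) = ∣ r - r′ ∣ ≤ 1 × ∣ t - t′ ∣ ≤ 1

record Placement (G : Graph) {C : Set} (R : C → C → Set) : Set where
  field
    pos           : Vertex G → C
    pos-injective : ∀ {u v} → pos u ≡ pos v → u ≡ v
    adj⇔          : ∀ u v → Adj G u v ⇔ (u ≢ v × R (pos u) (pos v))

open Placement

placement-≅ : ∀ {G H C} {R : C → C → Set} (P : Placement G R) (Q : Placement H R)
  (f : Vertex G → Vertex H) (g : Vertex H → Vertex G) →
  (∀ u → pos Q (f u) ≡ pos P u) → (∀ x → pos P (g x) ≡ pos Q x) → G ≅ H
placement-≅ {G} {H} {R = R} P Q f g pos-f pos-g =
  mk↔ₛ′ f g (λ x → pos-injective Q (trans (pos-f (g x)) (pos-g x)))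
            (λ u → pos-injective P (trans (pos-g (f u)) (pos-f u))) ,
  λ u v → preserve u v , reflect u v
  where
  f-injective : ∀ {u v} → f u ≡ f v → u ≡ v
  f-injective {u} {v} eq = pos-injective P (trans (sym (pos-f u)) (trans (cong (pos Q) eq) (pos-f v)))

  preserve : ∀ u v → Adj G u v → Adj H (f u) (f v)
  preserve u v adj with Equivalence.to (adj⇔ P u v) adj
  ... | u≢v , r = Equivalence.from (adj⇔ Q (f u) (f v))
    (u≢v ∘ f-injective , subst₂ R (sym (pos-f u)) (sym (pos-f v)) r)

  reflect : ∀ u v → Adj H (f u) (f v) → Adj G u v
  reflect u v adj with Equivalence.to (adj⇔ Q (f u) (f v)) adj
  ... | fu≢fv , r = Equivalence.from (adj⇔ P u v)
    (fu≢fv ∘ cong f , subst₂ R (pos-f u) (pos-f v) r)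

diagGrid-placement : ∀ n m → Placement (DiagGrid n m) King
diagGrid-placement n m = record
  { pos           = λ (i , j) → toℕ i , toℕ j
  ; pos-injective = λ eq → cong₂ _,_ (toℕ-injective (proj₁ (,-injective eq)))
                                     (toℕ-injective (proj₂ (,-injective eq)))
  ; adj⇔          = λ u v → mk⇔
      (λ (u≢v , squares≤2) → u≢v , Equivalence.to (squares≤2⇔≤1 _ _) squares≤2)
      (λ (u≢v , king) → u≢v , Equivalence.from (squares≤2⇔≤1 _ _) king)
  }

subset-≡ : ∀ {A : Set} {S : A → Bool} {x y : Σ A (T ∘ S)} → proj₁ x ≡ proj₁ y → x ≡ y
subset-≡ {x = a , s} {y = .a , s′} refl = cong (a ,_) (T-irrelevant s s′)

induced-placement : ∀ {G C} {R : C → C → Set} → Placement G R → ∀ S → Placement (Induced G S) R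
induced-placement P S = record
  { pos           = pos P ∘ proj₁
  ; pos-injective = λ eq → subset-≡ {S = S} (pos-injective P eq)
  ; adj⇔          = λ u v → mk⇔
      (λ adj → let (u≢v , r) = Equivalence.to (adj⇔ P _ _) adj in u≢v ∘ cong proj₁ , r)
      (λ (u≢v , r) → Equivalence.from (adj⇔ P _ _) (u≢v ∘ subset-≡ {S = S} , r))
  }

lower : ∀ {k} → PathEdge k → ℕ
lower ((u , _) , _) = toℕ u

pathEdge : ∀ {k} d → suc d < k → PathEdge k
pathEdge d 1+d<k = (fromℕ< (<⇒≤ 1+d<k) , fromℕ< 1+d<k) ,
  trans (toℕ-fromℕ< 1+d<k) (cong suc (sym (toℕ-fromℕ< (<⇒≤ 1+d<k))))

lower-pathEdge : ∀ {k} d (1+d<k : suc d < k) → lower (pathEdge d 1+d<k) ≡ d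
lower-pathEdge d 1+d<k = toℕ-fromℕ< (<⇒≤ 1+d<k)

lower< : ∀ {k} (e : PathEdge (suc k)) → lower e < k
lower< ((u , v) , v≡1+u) = subst (_≤ _) v≡1+u (s≤s⁻¹ (toℕ<n v))

pathEdge-meet⇔Near : ∀ {k} (e e′ : PathEdge k) → (∃[ w ] (w ∈ₑ e × w ∈ₑ e′)) ⇔ Near (lower e) (lower e′)
pathEdge-meet⇔Near ((u , v) , v≡1+u) ((u′ , v′) , v′≡1+u′) = mk⇔
  (λ (w , w∈e , w∈e′) → meet w∈e w∈e′)
  λ { (inj₁ u≡u′)          → u , inj₁ refl , inj₁ (toℕ-injective u≡u′)
    ; (inj₂ (inj₁ u≡1+u′)) → u , inj₁ refl , inj₂ (toℕ-injective (trans u≡1+u′ (sym v′≡1+u′)))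
    ; (inj₂ (inj₂ u′≡1+u)) → v , inj₂ refl , inj₁ (toℕ-injective (trans v≡1+u (sym u′≡1+u))) }
  where
  meet : ∀ {w} → w ≡ u ⊎ w ≡ v → w ≡ u′ ⊎ w ≡ v′ → Near (toℕ u) (toℕ u′)
  meet (inj₁ refl) (inj₁ refl) = inj₁ refl
  meet (inj₁ refl) (inj₂ refl) = inj₂ (inj₁ v′≡1+u′)
  meet (inj₂ refl) (inj₁ refl) = inj₂ (inj₂ v≡1+u)
  meet (inj₂ refl) (inj₂ refl) = inj₁ (suc-injective (trans (sym v≡1+u) v′≡1+u′))

∣a+m-a+n∣≤1⇔Near : ∀ a m n → ∣ a + m - a + n ∣ ≤ 1 ⇔ Near m n
∣a+m-a+n∣≤1⇔Near a m n rewrite ∣m+n-m+o∣≡∣n-o∣ a m n = mk⇔ (∣m-n∣≤1⇒Near m n) (Near⇒∣m-n∣≤1 m n)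

temporalLine-placement : ∀ {k} (lam : PathLabeling k) (a : ℕ) → Placement (TemporalLineGraph 2 k lam) King
temporalLine-placement {k} lam a = record
  { pos           = pos′
  ; pos-injective = injective _ _
  ; adj⇔          = λ x y → mk⇔
      (λ (x≢y , meet , t-close) →
        x≢y , Equivalence.from (∣a+m-a+n∣≤1⇔Near a _ _)
                (Equivalence.to (pathEdge-meet⇔Near (proj₁ x) (proj₁ y)) meet) , s≤s⁻¹ t-close)
      (λ (x≢y , u-close , t-close) →
        x≢y , Equivalence.from (pathEdge-meet⇔Near (proj₁ x) (proj₁ y))
                (Equivalence.to (∣a+m-a+n∣≤1⇔Near a _ _) u-close) , s≤s t-close)
  }
  where
  pos′ : Vertex (TemporalLineGraph 2 k lam) → ℕ × ℕ
  pos′ (e , t , _) = a + lower e , t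

  injective : ∀ x y → pos′ x ≡ pos′ y → x ≡ y
  injective (((u , v) , v≡1+u) , t , h) (((u′ , v′) , v′≡1+u′) , t′ , h′) eq
    with toℕ-injective {i = u} {j = u′} (+-cancelˡ-≡ a _ _ (proj₁ (,-injective eq)))
  ... | refl with toℕ-injective {i = v} {j = v′} (trans v≡1+u (sym v′≡1+u′)) | proj₂ (,-injective eq)
  ... | refl | refl with ≡-irrelevant v≡1+u v′≡1+u′
  ... | refl = cong (λ h → ((u , v) , v≡1+u) , t , h) (T-irrelevant h h′)

walk-intermediate-value : ∀ {G} (f : Vertex G → ℕ) → (∀ u v → Adj G u v → ∣ f u - f v ∣ ≤ 1) →
  ∀ {u v i} → Walk G u v → f u ≤ i → i ≤ f v → ∃[ w ] f w ≡ i
walk-intermediate-value f lipschitz {u} here fu≤i i≤fv = u , ≤-antisym fu≤i i≤fv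
walk-intermediate-value f lipschitz {u} {i = i} (step {v = w} adj walk) fu≤i i≤fv with f u ≟ i
... | yes fu≡i = u , fu≡i
... | no  fu≢i = walk-intermediate-value f lipschitz walk fw≤i i≤fv
  where
  open ≤-Reasoning
  fw≤i : f w ≤ i
  fw≤i = begin
    f w                 ≤⟨ m≤∣m-n∣+n (f w) (f u) ⟩
    ∣ f w - f u ∣ + f u ≡⟨ cong (_+ f u) (∣-∣-comm (f w) (f u)) ⟩
    ∣ f u - f w ∣ + f u ≤⟨ +-monoˡ-≤ (f u) (lipschitz u w adj) ⟩
    suc (f u)           ≤⟨ ≤∧≢⇒< fu≤i fu≢i ⟩
    i                   ∎

module _ {P : ℕ → Set} (P? : Decidable P) where

  least-below : ∀ m → (∃[ k ] (k < m × P k)) → ∃[ a ] (P a × ∀ {i} → P i → a ≤ i)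
  least-below (suc m) (k , k<1+m , pk) with anyUpTo? P? m
  ... | yes below = least-below m below
  ... | no  none  = m , subst P (≤-antisym (s≤s⁻¹ k<1+m) (minimal pk)) pk , minimal
    where
    minimal : ∀ {i} → P i → m ≤ i
    minimal pi = ≮⇒≥ λ i<m → none (_ , i<m , pi)

  least : ∀ {k} → P k → ∃[ a ] (P a × ∀ {i} → P i → a ≤ i)
  least {k} pk = least-below (suc k) (k , ≤-refl , pk)

  greatest : ∀ m → (∀ {i} → P i → i < m) → ∀ {k} → P k → ∃[ b ] (P b × ∀ {i} → P i → i ≤ b)
  greatest zero    bounded pk = contradiction (bounded pk) n≮0
  greatest (suc m) bounded pk with P? m
  ... | yes pm = m , pm , λ pi → s≤s⁻¹ (bounded pi)
  ... | no ¬pm = greatest m (λ pi → ≤∧≢⇒< (s≤s⁻¹ (bounded pi)) λ { refl → ¬pm pi }) pk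

emptyPath : PathLabeling 0
emptyPath = record { label = λ { ((() , _) , _) _ } ; nonempty = λ { ((() , _) , _) } }

module GridSubgraph {N M : ℕ} (S : Fin N × Fin M → Bool) where

  G : Graph
  G = Induced (DiagGrid N M) S

  placement : Placement G King
  placement = induced-placement (diagGrid-placement N M) S

  position : Vertex G → ℕ × ℕ
  position = pos placement

  row col : Vertex G → ℕ
  row = proj₁ ∘ position
  col = proj₂ ∘ position

  any-vertex? : ∀ {Q : Fin N × Fin M → Set} → Decidable Q → Dec (∃[ g ] Q (proj₁ g))
  any-vertex? Q? = map′ (λ (i , j , s , q) → ((i , j) , s) , q) (λ (((i , j) , s) , q) → i , j , s , q)
    (any? λ i → any? λ j → T? (S (i , j)) ×-dec Q? (i , j))

  vertex? : Dec (Vertex G)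
  vertex? = map′ proj₁ (_, tt) (any-vertex? {Q = λ _ → ⊤} (λ _ → yes tt))

  Occupied : ℕ × ℕ → Set
  Occupied p = ∃[ g ] position g ≡ p

  occupied? : Decidable Occupied
  occupied? p = any-vertex? (λ (i , j) → ×-≡-dec _≟_ _≟_ (toℕ i , toℕ j) p)

  OccupiedRow : ℕ → Set
  OccupiedRow r = ∃[ g ] row g ≡ r

  occupiedRow? : Decidable OccupiedRow
  occupiedRow? r = any-vertex? (λ (i , _) → toℕ i ≟ r)

  RowsSpan : ℕ → ℕ → Set
  RowsSpan a b = ∀ r → OccupiedRow r ⇔ (a ≤ r × r ≤ b)

  row<N : ∀ {r} → OccupiedRow r → r < N
  row<N (((i , _) , _) , refl) = toℕ<n i

  rows-span : Connected G → Vertex G → ∃[ a ] ∃[ b ] (a ≤ b × b < N × RowsSpan a b)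
  rows-span connected g₀
    with least occupiedRow? (g₀ , refl) | greatest occupiedRow? N row<N (g₀ , refl)
  ... | a , (g-a , row-a) , a-least | b , (g-b , row-b) , b-greatest =
    a , b , a-least (g-b , row-b) , row<N (g-b , row-b) ,
    λ r → mk⇔ (λ occupied → a-least occupied , b-greatest occupied) (between r)
    where
    row-lipschitz : ∀ u v → Adj G u v → ∣ row u - row v ∣ ≤ 1
    row-lipschitz u v adj = proj₁ (proj₂ (Equivalence.to (adj⇔ placement u v) adj))

    between : ∀ r → a ≤ r × r ≤ b → OccupiedRow r
    between r (a≤r , r≤b) = walk-intermediate-value row row-lipschitz (connected g-a g-b)
      (subst (_≤ r) (sym row-a) a≤r) (subst (r ≤_) (sym row-b) r≤b)

  module Realisation {a b : ℕ} (a≤b : a ≤ b) (span : RowsSpan a b) where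

    edge-row-bounds : ∀ (e : PathEdge (2 + (b ∸ a))) → a ≤ a + lower e × a + lower e ≤ b
    edge-row-bounds e = m≤m+n a (lower e) ,
      ≤-trans (+-monoʳ-≤ a (s≤s⁻¹ (lower< e))) (≤-reflexive (m+[n∸m]≡n a≤b))

    some-occupied-time : ∀ e → ∃[ t ] True (occupied? (a + lower e , t))
    some-occupied-time e with Equivalence.from (span (a + lower e)) (edge-row-bounds e)
    ... | g , row≡ = col g , fromWitness (g , cong (_, col g) row≡)

    labeling : PathLabeling (2 + (b ∸ a))
    labeling = record
      { label    = λ e t → ⌊ occupied? (a + lower e , t) ⌋
      ; nonempty = some-occupied-time
      }

    L : Graph
    L = TemporalLineGraph 2 (2 + (b ∸ a)) labeling

    line-placement : Placement L King
    line-placement = temporalLine-placement labeling a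

    row-bounds : ∀ g → a ≤ row g × row g ≤ b
    row-bounds g = Equivalence.to (span (row g)) (g , refl)

    edge-index< : ∀ g → suc (row g ∸ a) < 2 + (b ∸ a)
    edge-index< g = s≤s (s≤s (∸-monoˡ-≤ a (proj₂ (row-bounds g))))

    edge : Vertex G → PathEdge (2 + (b ∸ a))
    edge g = pathEdge (row g ∸ a) (edge-index< g)

    a+lower-edge : ∀ g → a + lower (edge g) ≡ row g
    a+lower-edge g = trans (cong (a +_) (lower-pathEdge (row g ∸ a) (edge-index< g)))
                           (m+[n∸m]≡n (proj₁ (row-bounds g)))

    toLine : Vertex G → Vertex L
    toLine g = edge g , col g , fromWitness (g , cong (_, col g) (sym (a+lower-edge g)))

    fromLine : Vertex L → Vertex G
    fromLine (_ , _ , occupied) = proj₁ (toWitness occupied)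

    G≅L : G ≅ L
    G≅L = placement-≅ placement line-placement toLine fromLine
      (λ g → cong (_, col g) (a+lower-edge g))
      (λ (_ , _ , occupied) → proj₂ (toWitness occupied))

  empty-≅ : ¬ Vertex G → G ≅ TemporalLineGraph 2 0 emptyPath
  empty-≅ no-vertex = placement-≅ placement (temporalLine-placement emptyPath 0)
    (⊥-elim ∘ no-vertex) (λ { (((() , _) , _) , _) })
    (⊥-elim ∘ no-vertex) (λ { (((() , _) , _) , _) })

  temporal-line-realisation : Connected G →
    ∃[ n′ ] (n′ ≤ suc N × Σ (PathLabeling n′) λ lam → G ≅ TemporalLineGraph 2 n′ lam)
  temporal-line-realisation connected with vertex?
  ... | no  no-vertex = 0 , z≤n , emptyPath , empty-≅ no-vertex
  ... | yes g₀ with rows-span connected g₀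
  ...   | a , b , a≤b , b<N , span =
    2 + (b ∸ a) , s≤s (≤-trans (s≤s (m∸n≤m b a)) b<N) , labeling , G≅L
    where open Realisation a≤b span

corollary3p12 : (n T : ℕ) → 2 ≤ n → 1 ≤ T →
    (S : Vertex (DiagGrid (n ∸ 1) T) → Bool) →
    Connected (Induced (DiagGrid (n ∸ 1) T) S) →
    ∃[ n' ] (n' ≤ n × Σ (PathLabeling n') λ lam →
      Induced (DiagGrid (n ∸ 1) T) S ≅ TemporalLineGraph 2 n' lam)
corollary3p12 zero    _ ()  _ _ _
corollary3p12 (suc n) _ _   _ S connected = GridSubgraph.temporal-line-realisation S connected
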